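{- The linear map $\mathcal M\to\mathcal M$, $[\mathsf M,\eta]\mapsto[\mathsf M^*,\eta]$, is a grading-transposing isomorphism of bicomplexes from $(\mathcal M_{\bullet,\bullet},\partial_{\mathrm{del}},\partial_{\mathrm{clp}})$ to $(\mathcal M_{\bullet,\bullet},\partial_{\mathrm{lp}},\partial_{\mathrm{con}})$: it is a linear isomorphism sending $\mathcal M_{k,r}$ onto $\mathcal M_{r,k}$ for all $k,r$, and it satisfies $\phi\circ\partial_{\mathrm{del}}=\partial_{\mathrm{con}}\circ\phi$ and $\phi\circ\partial_{\mathrm{clp}}=\partial_{\mathrm{lp}}\circ\phi$, where $\phi$ denotes this map.
   Context: $\mathsf M^*$ is the dual matroid of $\mathsf M$ (same ground set, bases the complements of bases of $\mathsf M$). An orientation of $\mathsf M$ is a generator $\eta$ of $\bigwedge^{|E|}\mathbb{Z}\langle E\rangle$, $E=E(\mathsf M)$ (hence also an orientation of $\mathsf M^*$). $\mathcal M$ is the $\mathbb{Q}$-vector space spanned by symbols $[\mathsf M,\eta]$ modulo $[\mathsf M,-\eta]=-[\mathsf M,\eta]$ and $[\mathsf M,\eta]=[\mathsf M',\psi_*\eta]$ for every matroid isomorphism $\psi:\mathsf M\to\mathsf M'$ ($\psi_*$ the induced map on top exterior powers), with $\mathcal M_{k,r}$ spanned by classes of nullity $k=|E|-\mathrm{rk}(\mathsf M)$ and rank $r$. With $\iota_x$ interior product ($\iota_x(x\wedge\alpha)=\alpha$): $\partial_{\mathrm{del}}[\mathsf M,\eta]=\sum_{x\text{ not a coloop}}[\mathsf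 M\setminus x,\iota_x\eta]$, $\partial_{\mathrm{clp}}[\mathsf M,\eta]=\sum_{x\text{ a coloop}}[\mathsf M\setminus x,\iota_x\eta]$, $\partial_{\mathrm{con}}[\mathsf M,\eta]=\sum_{x\text{ not a loop}}[\mathsf M/x,\iota_x\eta]$, $\partial_{\mathrm{lp}}[\mathsf M,\eta]=\sum_{x\text{ a loop}}[\mathsf M/x,\iota_x\eta]$; these give bicomplexes $(\mathcal M_{\bullet,\bullet},\partial_{\mathrm{del}},\partial_{\mathrm{clp}})$ and $(\mathcal M_{\bullet,\bullet},\partial_{\mathrm{lp}},\partial_{\mathrm{con}})$ (first differential horizontal, second vertical). -}

module Defs where

open import Data.Nat using (ℕ; zero; suc; _<ᵇ_)
import Data.Nat as ℕ
open import Data.Bool using (Bool; true; false; not; _∧_; _∨_; if_then_else_)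
open import Data.Fin using (Fin; toℕ)
open import Data.Fin.Subset using (Subset; _∈_; _∉_; ∣_∣; ∁)
open import Data.Fin.Permutation using (Permutation′; _⟨$⟩ʳ_; _⟨$⟩ˡ_)
open import Data.Vec using (Vec; []; _∷_; _[_]≔_; insertAt; lookup; tabulate)
open import Data.List using (List; []; _∷_; _++_; map; concatMap; filter; allFin; [_])
open import Data.Bool.ListAction using (and)
open import Data.Nat.ListAction using (sum)
open import Data.List.Relation.Unary.All using (All)
open import Data.Rational using (ℚ; 0ℚ; _+_; _*_; -_)
open import Data.Sign using (Sign; opposite) renaming (+ to plus; - to minus; _*_ to _*ₛ_)
open import Data.Product using (_×_; _,_; ∃; proj₁; proj₂)
open import Relation.Binary.PropositionalEquality using (_≡_)
open import Relation.Nullary using (¬_)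

-- Matroids on the ground set Fin n, given by their bases.
-- A "basis system" is a Boolean predicate on subsets of Fin n
-- (B is a basis iff 𝓑 B ≡ true).

BasisSystem : ℕ → Set
BasisSystem n = Subset n → Bool

IsBasis : ∀ {n} → BasisSystem n → Subset n → Set
IsBasis 𝓑 B = 𝓑 B ≡ true

record IsMatroid {n : ℕ} (𝓑 : BasisSystem n) : Set where
  field
    nonempty : ∃ λ B → IsBasis 𝓑 B
    exchange : ∀ B₁ B₂ → IsBasis 𝓑 B₁ → IsBasis 𝓑 B₂ →
               ∀ x → x ∈ B₁ → x ∉ B₂ →
               ∃ λ y → y ∈ B₂ × y ∉ B₁ × IsBasis 𝓑 ((B₁ [ x ]≔ false) [ y ]≔ true)

allSubsets : (n : ℕ) → List (Subset n)
allSubsets zero = [] ∷ []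
allSubsets (suc n) = map (true ∷_) (allSubsets n) ++ map (false ∷_) (allSubsets n)

isColoop : ∀ {n} → BasisSystem n → Fin n → Bool
isColoop 𝓑 x = and (map (λ B → not (𝓑 B) ∨ lookup B x) (allSubsets _))

isLoop : ∀ {n} → BasisSystem n → Fin n → Bool
isLoop 𝓑 x = and (map (λ B → not (𝓑 B) ∨ not (lookup B x)) (allSubsets _))

-- Deletion M \ x and contraction M / x, with ground set E \ {x}
-- identified with Fin n via the order-preserving map (insertAt).
deleteB : ∀ {n} → BasisSystem (suc n) → Fin (suc n) → BasisSystem n
deleteB 𝓑 x B′ = if isColoop 𝓑 x then 𝓑 (insertAt B′ x true) else 𝓑 (insertAt B′ x false)

contractB : ∀ {n} → BasisSystem (suc n) → Fin (suc n) → BasisSystem n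
contractB 𝓑 x B′ = if isLoop 𝓑 x then 𝓑 (insertAt B′ x false) else 𝓑 (insertAt B′ x true)

dualB : ∀ {n} → BasisSystem n → BasisSystem n
dualB 𝓑 B = 𝓑 (∁ B)

HasNullityRank : ∀ {n} → BasisSystem n → ℕ → ℕ → Set
HasNullityRank {n} 𝓑 k r = n ≡ k ℕ.+ r × ∃ λ B → IsBasis 𝓑 B × ∣ B ∣ ≡ r

-- Orientations.  The top exterior power of ℤ⟨Fin n⟩ is generated by
-- ω = e₀ ∧ … ∧ e_{n-1}; its two generators are s·ω, s a sign.

parity : ℕ → Sign
parity zero = plus
parity (suc k) = opposite (parity k)

inversions : ∀ {n} → Permutation′ n → ℕ
inversions {n} σ =
  sum (map (λ i → sum (map (λ j →
         if (toℕ i <ᵇ toℕ j) ∧ (toℕ (σ ⟨$⟩ʳ j) <ᵇ toℕ (σ ⟨$⟩ʳ i)) then 1 else 0)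
       (allFin n))) (allFin n))

sgn : ∀ {n} → Permutation′ n → Sign
sgn σ = parity (inversions σ)

image : ∀ {n} → Permutation′ n → Subset n → Subset n
image σ B = tabulate (λ j → lookup B (σ ⟨$⟩ˡ j))

IsIso : ∀ {n} → Permutation′ n → BasisSystem n → BasisSystem n → Set
IsIso σ 𝓑 𝓑′ = ∀ B → 𝓑′ (image σ B) ≡ 𝓑 B

-- an oriented matroid symbol [M, η] with η = orient · ω
record OMat : Set where
  constructor omat
  field
    size   : ℕ
    bases  : BasisSystem size
    orient : Sign
open OMat public

-- ψ_* ω = sgn σ · ω ;  ι_x ω = (-1)^x · ω′  (ω′ the standard generator on E \ x)

FSum : Set
FSum = List (ℚ × OMat)

scale : ℚ → FSum → FSum
scale c = map (λ p → (c * proj₁ p , proj₂ p))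

infix 4 _≈_
data _≈_ : FSum → FSum → Set where
  ≈-refl  : ∀ {x} → x ≈ x
  ≈-sym   : ∀ {x y} → x ≈ y → y ≈ x
  ≈-trans : ∀ {x y z} → x ≈ y → y ≈ z → x ≈ z
  ≈-++    : ∀ {x x′ y y′} → x ≈ x′ → y ≈ y′ → x ++ y ≈ x′ ++ y′
  ≈-scale : ∀ {x y} c → x ≈ y → scale c x ≈ scale c y
  ≈-comm  : ∀ x y → x ++ y ≈ y ++ x
  ≈-zero  : ∀ g → [] ≈ [ (0ℚ , g) ]
  ≈-merge : ∀ a b g → (a , g) ∷ (b , g) ∷ [] ≈ [ (a + b , g) ]
  ≈-neg   : ∀ a n (𝓑 : BasisSystem n) s →
            [ (a , omat n 𝓑 (opposite s)) ] ≈ [ (- a , omat n 𝓑 s) ]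
  ≈-iso   : ∀ a n (𝓑 𝓑′ : BasisSystem n) s (σ : Permutation′ n) → IsIso σ 𝓑 𝓑′ →
            [ (a , omat n 𝓑 s) ] ≈ [ (a , omat n 𝓑′ (sgn σ *ₛ s)) ]

AllMatroid : FSum → Set
AllMatroid = All (λ p → IsMatroid (bases (proj₂ p)))

InGrade : ℕ → ℕ → FSum → Set
InGrade k r x = ∃ λ y → x ≈ y ×
  All (λ p → IsMatroid (bases (proj₂ p)) × HasNullityRank (bases (proj₂ p)) k r) y

φ : FSum → FSum
φ = map (λ p → (proj₁ p , omat (size (proj₂ p)) (dualB (bases (proj₂ p))) (orient (proj₂ p))))

linExt : (OMat → List OMat) → FSum → FSum
linExt f = concatMap (λ p → map (λ M → (proj₁ p , M)) (f (proj₂ p)))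

delTerms clpTerms conTerms lpTerms : OMat → List OMat
delTerms (omat zero 𝓑 s) = []
delTerms (omat (suc n) 𝓑 s) =
  map (λ x → omat n (deleteB 𝓑 x) (s *ₛ parity (toℕ x)))
      (filter (λ x → Relation.Nullary.Decidable.T? (not (isColoop 𝓑 x))) (allFin (suc n)))
  where import Relation.Nullary.Decidable
clpTerms (omat zero 𝓑 s) = []
clpTerms (omat (suc n) 𝓑 s) =
  map (λ x → omat n (deleteB 𝓑 x) (s *ₛ parity (toℕ x)))
      (filter (λ x → Relation.Nullary.Decidable.T? (isColoop 𝓑 x)) (allFin (suc n)))
  where import Relation.Nullary.Decidable
conTerms (omat zero 𝓑 s) = []
conTerms (omat (suc n) 𝓑 s) =
  map (λ x → omat n (contractB 𝓑 x) (s *ₛ parity (toℕ x)))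
      (filter (λ x → Relation.Nullary.Decidable.T? (not (isLoop 𝓑 x))) (allFin (suc n)))
  where import Relation.Nullary.Decidable
lpTerms (omat zero 𝓑 s) = []
lpTerms (omat (suc n) 𝓑 s) =
  map (λ x → omat n (contractB 𝓑 x) (s *ₛ parity (toℕ x)))
      (filter (λ x → Relation.Nullary.Decidable.T? (isLoop 𝓑 x)) (allFin (suc n)))
  where import Relation.Nullary.Decidable

∂del ∂clp ∂con ∂lp : FSum → FSum
∂del = linExt delTerms
∂clp = linExt clpTerms
∂con = linExt conTerms
∂lp  = linExt lpTerms

-- The bases of M* are the complements of those of M, and complementation is an involution on
-- subsets. So φ is an involution, hence bijective; it respects the defining relations of 𝓜
-- because complementation commutes with relabelling; and ∣ ∁ B ∣ = |E| ∸ ∣ B ∣ swaps rank and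
-- nullity. Complementation turns "x lies in every basis" into "x lies in no basis": the coloops
-- of M are the loops of M*, and M \ x has the same bases as (M* / x)*, so φ sends each term of
-- ∂del and ∂clp to the term of ∂con and ∂lp with the same index x, hence the same sign (-1)^x.
-- The one non-formal point is that M* is a matroid at all: its basis exchange axiom is the dual
-- basis exchange property of M.

module Submission where

open import Defs
open import Data.Nat using (ℕ; zero; suc; _+_; _<_; _<ᵇ_; _∸_)
open import Data.Nat.Properties using (+-comm; m+n∸n≡m; n<1+n; module ≤-Reasoning)
open import Data.Nat.Induction using (<-wellFounded)
open import Data.Nat.ListAction using (sum)
open import Data.Product using (_×_; ∃; _,_)
import Data.Product as Product
open import Data.Bool using (Bool; true; false; not; _∧_; _∨_; if_then_else_; T)
open import Data.Bool.Properties using (not-involutive; ∧-comm; ∧-assoc)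
open import Data.Bool.ListAction using (and)
open import Data.Fin using (toℕ)
open import Data.Fin.Properties using (any?; _≟_)
open import Data.Fin.Subset using (Subset; _∈_; _∉_; ∣_∣; ∁; _∩_)
open import Data.Fin.Subset.Properties
  using (_∈?_; ∣∁p∣≡n∸∣p∣; x∈p⇒x∉∁p; x∉p⇒x∈∁p; x∈∁p⇒x∉p; x∉∁p⇒x∈p)
open import Data.Fin.Permutation using (Permutation′; _⟨$⟩ˡ_) renaming (id to idₚ)
open import Data.Vec using ([]; _∷_; _[_]≔_; here; there; lookup)
open import Data.Vec.Properties
  using (map-[]≔; []≔-commutes; []≔-updates; []≔-minimal; map-insertAt; lookup-map;
         tabulate∘lookup; tabulate-∘; tabulate-cong)
open import Data.List using ([]; _∷_; _++_; map; filter; [_]; allFin)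
open import Data.List.Properties using (map-++; map-∘; map-cong; filter-≐)
import Data.List.Relation.Unary.All as All
open import Data.List.Relation.Unary.All.Properties using (map⁺)
open import Data.Sign using () renaming (+ to plus; _*_ to _*ₛ_)
open import Function using (_∘_)
open import Induction.WellFounded using (Acc; acc)
open import Relation.Binary.PropositionalEquality
  using (_≡_; _≢_; _≗_; refl; sym; trans; cong; cong₂; subst; module ≡-Reasoning)
open import Relation.Nullary using (yes; no; contradiction)
open import Relation.Nullary.Decidable using (_×-dec_; ¬?; T?)

∁-involutive : ∀ {n} (B : Subset n) → ∁ (∁ B) ≡ B
∁-involutive []      = refl
∁-involutive (b ∷ B) = cong₂ _∷_ (not-involutive b) (∁-involutive B)

∁-exchange : ∀ {n} (D : Subset n) {x y} → x ≢ y →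
             ∁ ((D [ x ]≔ false) [ y ]≔ true) ≡ (∁ D [ y ]≔ false) [ x ]≔ true
∁-exchange D {x} {y} x≢y = begin
  ∁ ((D [ x ]≔ false) [ y ]≔ true)  ≡⟨ map-[]≔ not (D [ x ]≔ false) y ⟩
  ∁ (D [ x ]≔ false) [ y ]≔ false   ≡⟨ cong (_[ y ]≔ false) (map-[]≔ not D x) ⟩
  (∁ D [ x ]≔ true) [ y ]≔ false    ≡⟨ []≔-commutes (∁ D) x y x≢y ⟩
  (∁ D [ y ]≔ false) [ x ]≔ true    ∎
  where open ≡-Reasoning

∣∩∁∣-remove : ∀ {n} {p q : Subset n} {z} → z ∈ p → z ∉ q →
              suc ∣ (p [ z ]≔ false) ∩ ∁ q ∣ ≡ ∣ p ∩ ∁ q ∣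
∣∩∁∣-remove {p = true  ∷ _} {false ∷ _} here        z∉q = refl
∣∩∁∣-remove {p = true  ∷ _} {true  ∷ _} here        z∉q = contradiction here z∉q
∣∩∁∣-remove {p = true  ∷ _} {false ∷ _} (there z∈p) z∉q = cong suc (∣∩∁∣-remove z∈p (z∉q ∘ there))
∣∩∁∣-remove {p = true  ∷ _} {true  ∷ _} (there z∈p) z∉q = ∣∩∁∣-remove z∈p (z∉q ∘ there)
∣∩∁∣-remove {p = false ∷ _} {_     ∷ _} (there z∈p) z∉q = ∣∩∁∣-remove z∈p (z∉q ∘ there)

∣∩∁∣-insert : ∀ {n} (p : Subset n) {q w} → w ∈ q → ∣ (p [ w ]≔ true) ∩ ∁ q ∣ ≡ ∣ p ∩ ∁ q ∣
∣∩∁∣-insert (true  ∷ p) here                = refl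
∣∩∁∣-insert (false ∷ p) here                = refl
∣∩∁∣-insert (true  ∷ p) {false ∷ _} (there w∈q) = cong suc (∣∩∁∣-insert p w∈q)
∣∩∁∣-insert (true  ∷ p) {true  ∷ _} (there w∈q) = ∣∩∁∣-insert p w∈q
∣∩∁∣-insert (false ∷ p) {_     ∷ _} (there w∈q) = ∣∩∁∣-insert p w∈q

∣∩∁∣-exchange : ∀ {n} {p q : Subset n} {z w} → z ∈ p → z ∉ q → w ∈ q →
                ∣ ((p [ z ]≔ false) [ w ]≔ true) ∩ ∁ q ∣ < ∣ p ∩ ∁ q ∣
∣∩∁∣-exchange {p = p} {q} {z} {w} z∈p z∉q w∈q = begin-strict
  ∣ ((p [ z ]≔ false) [ w ]≔ true) ∩ ∁ q ∣ ≡⟨ ∣∩∁∣-insert (p [ z ]≔ false) w∈q ⟩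
  ∣ (p [ z ]≔ false) ∩ ∁ q ∣               <⟨ n<1+n _ ⟩
  suc ∣ (p [ z ]≔ false) ∩ ∁ q ∣           ≡⟨ ∣∩∁∣-remove z∈p z∉q ⟩
  ∣ p ∩ ∁ q ∣                              ∎
  where open ≤-Reasoning

∈-exchange⁺ : ∀ {n} {B : Subset n} {v z w} → v ∈ B → v ≢ z → v ≢ w →
              v ∈ (B [ z ]≔ false) [ w ]≔ true
∈-exchange⁺ {B = B} {v} {z} {w} v∈B v≢z v≢w =
  []≔-minimal (B [ z ]≔ false) v w v≢w ([]≔-minimal B v z v≢z v∈B)

-- Exchanging some z ≠ x of B₂ \ B₁ into B₁ keeps x in B₂ and shrinks B₂ \ B₁; once B₂ \ B₁ = {x},
-- exchanging x out of B₂ yields some w ∈ B₁ \ B₂, and exchanging w back into B₂ can only bring in x.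
dual-exchange : ∀ {n} {𝓑 : BasisSystem n} → IsMatroid 𝓑 →
                ∀ B₁ B₂ → IsBasis 𝓑 B₁ → IsBasis 𝓑 B₂ → ∀ x → x ∉ B₁ → x ∈ B₂ →
                ∃ λ y → y ∈ B₁ × y ∉ B₂ × IsBasis 𝓑 ((B₁ [ y ]≔ false) [ x ]≔ true)
dual-exchange {𝓑 = 𝓑} isMatroid B₁ B₂ b₁ b₂ x x∉B₁ x∈B₂ = go B₂ b₂ x∈B₂ (<-wellFounded _)
  where
  open IsMatroid isMatroid

  go : ∀ B → IsBasis 𝓑 B → x ∈ B → Acc _<_ ∣ B ∩ ∁ B₁ ∣ →
     ∃ λ y → y ∈ B₁ × y ∉ B × IsBasis 𝓑 ((B₁ [ y ]≔ false) [ x ]≔ true)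
  go B b x∈B (acc rec) with any? (λ z → z ∈? B ×-dec ¬? (z ∈? B₁) ×-dec ¬? (z ≟ x))
  ... | yes (z , z∈B , z∉B₁ , z≢x) with exchange B B₁ b b₁ z z∈B z∉B₁
  ...   | w , w∈B₁ , w∉B , b′
    with go _ b′ (∈-exchange⁺ x∈B (z≢x ∘ sym) λ { refl → w∉B x∈B })
                 (rec (∣∩∁∣-exchange z∈B z∉B₁ w∈B₁))
  ...     | y , y∈B₁ , y∉B′ , b₁′ = y , y∈B₁ , y∉B , b₁′
    where
    y∉B : y ∉ B
    y∉B y∈B = y∉B′ (∈-exchange⁺ y∈B (λ { refl → z∉B₁ y∈B₁ }) λ { refl → y∉B′ ([]≔-updates _ w) })
  go B b x∈B (acc rec) | no ∄z with exchange B B₁ b b₁ x x∈B x∉B₁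
  ... | w , w∈B₁ , w∉B , _ with exchange B₁ B b₁ b w w∈B₁ w∉B
  ...   | y , y∈B , y∉B₁ , b₁′ with y ≟ x
  ...     | yes refl = w , w∈B₁ , w∉B , b₁′
  ...     | no y≢x   = contradiction (y , y∈B , y∉B₁ , y≢x) ∄z

dual-isMatroid : ∀ {n} {𝓑 : BasisSystem n} → IsMatroid 𝓑 → IsMatroid (dualB 𝓑)
dual-isMatroid {𝓑 = 𝓑} isMatroid = record { nonempty = nonempty* ; exchange = exchange* }
  where
  open IsMatroid isMatroid

  nonempty* : ∃ λ D → IsBasis (dualB 𝓑) D
  nonempty* = let B , b = nonempty in ∁ B , subst (IsBasis 𝓑) (sym (∁-involutive B)) b

  exchange* : ∀ D₁ D₂ → IsBasis (dualB 𝓑) D₁ → IsBasis (dualB 𝓑) D₂ → ∀ x → x ∈ D₁ → x ∉ D₂ →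
              ∃ λ y → y ∈ D₂ × y ∉ D₁ × IsBasis (dualB 𝓑) ((D₁ [ x ]≔ false) [ y ]≔ true)
  exchange* D₁ D₂ d₁ d₂ x x∈D₁ x∉D₂
    with dual-exchange isMatroid (∁ D₁) (∁ D₂) d₁ d₂ x (x∈p⇒x∉∁p x∈D₁) (x∉p⇒x∈∁p x∉D₂)
  ... | y , y∈∁D₁ , y∉∁D₂ , b =
    y , x∉∁p⇒x∈p y∉∁D₂ , y∉D₁ , subst (IsBasis 𝓑) (sym (∁-exchange D₁ λ { refl → y∉D₁ x∈D₁ })) b
    where
    y∉D₁ : y ∉ D₁
    y∉D₁ = x∈∁p⇒x∉p y∈∁D₁

and-++ : ∀ xs ys → and (xs ++ ys) ≡ and xs ∧ and ys
and-++ []       ys = refl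
and-++ (x ∷ xs) ys = trans (cong (x ∧_) (and-++ xs ys)) (sym (∧-assoc x (and xs) (and ys)))

and-allSubsets-suc : ∀ n (f : Subset (suc n) → Bool) →
                     and (map f (allSubsets (suc n))) ≡
                     and (map (f ∘ (true ∷_)) (allSubsets n)) ∧ and (map (f ∘ (false ∷_)) (allSubsets n))
and-allSubsets-suc n f = begin
  and (map f (map (true ∷_) A ++ map (false ∷_) A))          ≡⟨ cong and (map-++ f (map (true ∷_) A) _) ⟩
  and (map f (map (true ∷_) A) ++ map f (map (false ∷_) A))  ≡⟨ and-++ (map f (map (true ∷_) A)) _ ⟩
  and (map f (map (true ∷_) A)) ∧ and (map f (map (false ∷_) A))
    ≡⟨ cong₂ (λ u v → and u ∧ and v) (map-∘ {g = f} A) (map-∘ {g = f} A) ⟨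
  and (map (f ∘ (true ∷_)) A) ∧ and (map (f ∘ (false ∷_)) A)  ∎
  where
  open ≡-Reasoning
  A = allSubsets n

-- ∁ exchanges the two halves of allSubsets (suc n).
and-allSubsets-∁ : ∀ n (f : Subset n → Bool) →
                   and (map f (allSubsets n)) ≡ and (map (f ∘ ∁) (allSubsets n))
and-allSubsets-∁ zero    f = refl
and-allSubsets-∁ (suc n) f = begin
  and (map f (allSubsets (suc n)))                                      ≡⟨ and-allSubsets-suc n f ⟩
  and (map (f ∘ (true ∷_)) A) ∧ and (map (f ∘ (false ∷_)) A)
    ≡⟨ cong₂ _∧_ (and-allSubsets-∁ n (f ∘ (true ∷_))) (and-allSubsets-∁ n (f ∘ (false ∷_))) ⟩
  and (map (f ∘ (true ∷_) ∘ ∁) A) ∧ and (map (f ∘ (false ∷_) ∘ ∁) A)  ≡⟨ ∧-comm (and (map (f ∘ (true ∷_) ∘ ∁) A)) _ ⟩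
  and (map (f ∘ ∁ ∘ (true ∷_)) A) ∧ and (map (f ∘ ∁ ∘ (false ∷_)) A)  ≡⟨ and-allSubsets-suc n (f ∘ ∁) ⟨
  and (map (f ∘ ∁) (allSubsets (suc n)))                                ∎
  where
  open ≡-Reasoning
  A = allSubsets n

isColoop≡isLoop-dual : ∀ {n} (𝓑 : BasisSystem n) x → isColoop 𝓑 x ≡ isLoop (dualB 𝓑) x
isColoop≡isLoop-dual {n} 𝓑 x = sym (begin
  isLoop (dualB 𝓑) x
    ≡⟨ and-allSubsets-∁ n _ ⟩
  and (map (λ B → not (𝓑 (∁ (∁ B))) ∨ not (lookup (∁ B) x)) (allSubsets n))
    ≡⟨ cong and (map-cong pointwise (allSubsets n)) ⟩
  isColoop 𝓑 x  ∎)
  where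
  open ≡-Reasoning
  pointwise : ∀ B → not (𝓑 (∁ (∁ B))) ∨ not (lookup (∁ B) x) ≡ not (𝓑 B) ∨ lookup B x
  pointwise B = cong₂ (λ C b → not (𝓑 C) ∨ b) (∁-involutive B)
                      (trans (cong not (lookup-map x not B)) (not-involutive _))

dualB-deleteB : ∀ {n} (𝓑 : BasisSystem (suc n)) x → dualB (deleteB 𝓑 x) ≗ contractB (dualB 𝓑) x
dualB-deleteB 𝓑 x B
  rewrite sym (isColoop≡isLoop-dual 𝓑 x) | map-insertAt not false B x | map-insertAt not true B x
  with isColoop 𝓑 x
... | true  = refl
... | false = refl

<ᵇ-asym : ∀ m n → (m <ᵇ n) ∧ (n <ᵇ m) ≡ false
<ᵇ-asym zero    zero    = refl
<ᵇ-asym zero    (suc n) = refl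
<ᵇ-asym (suc m) zero    = refl
<ᵇ-asym (suc m) (suc n) = <ᵇ-asym m n

sum-map-≡0 : ∀ {A : Set} (f : A → ℕ) xs → (∀ x → f x ≡ 0) → sum (map f xs) ≡ 0
sum-map-≡0 f []       f≡0 = refl
sum-map-≡0 f (x ∷ xs) f≡0 = cong₂ _+_ (f≡0 x) (sum-map-≡0 f xs f≡0)

sgn-id : ∀ n → sgn (idₚ {n}) ≡ plus
sgn-id n = cong parity (sum-map-≡0 _ (allFin n) λ i → sum-map-≡0 _ (allFin n) λ j →
  cong (λ b → if b then 1 else 0) (<ᵇ-asym (toℕ i) (toℕ j)))

image-id : ∀ {n} (B : Subset n) → image idₚ B ≡ B
image-id = tabulate∘lookup

∁-image : ∀ {n} (σ : Permutation′ n) B → ∁ (image σ B) ≡ image σ (∁ B)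
∁-image σ B = trans (sym (tabulate-∘ not _)) (tabulate-cong λ j → sym (lookup-map (σ ⟨$⟩ˡ j) not B))

≈-bases : ∀ a n {𝓑 𝓑′ : BasisSystem n} s → 𝓑 ≗ 𝓑′ →
          [ (a , omat n 𝓑 s) ] ≈ [ (a , omat n 𝓑′ s) ]
≈-bases a n {𝓑} {𝓑′} s 𝓑≗𝓑′ =
  subst (λ t → [ (a , omat n 𝓑 s) ] ≈ [ (a , omat n 𝓑′ (t *ₛ s)) ]) (sgn-id n)
        (≈-iso a n 𝓑 𝓑′ s idₚ λ B → trans (cong 𝓑′ (image-id B)) (sym (𝓑≗𝓑′ B)))

dualᴼ : OMat → OMat
dualᴼ M = omat (size M) (dualB (bases M)) (orient M)

φ-++ : ∀ x y → φ (x ++ y) ≡ φ x ++ φ y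
φ-++ = map-++ _

φ-scale : ∀ c x → φ (scale c x) ≡ scale c (φ x)
φ-scale c []      = refl
φ-scale c (p ∷ x) = cong (_ ∷_) (φ-scale c x)

φ-cong : ∀ {x y} → x ≈ y → φ x ≈ φ y
φ-cong ≈-refl                = ≈-refl
φ-cong (≈-sym e)             = ≈-sym (φ-cong e)
φ-cong (≈-trans e f)         = ≈-trans (φ-cong e) (φ-cong f)
φ-cong (≈-++ {x} {x′} {y} {y′} e f)
  rewrite φ-++ x y | φ-++ x′ y′ = ≈-++ (φ-cong e) (φ-cong f)
φ-cong (≈-scale {x} {y} c e)
  rewrite φ-scale c x | φ-scale c y = ≈-scale c (φ-cong e)
φ-cong (≈-comm x y)
  rewrite φ-++ x y | φ-++ y x = ≈-comm (φ x) (φ y)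
φ-cong (≈-zero g)            = ≈-zero (dualᴼ g)
φ-cong (≈-merge a b g)       = ≈-merge a b (dualᴼ g)
φ-cong (≈-neg a n 𝓑 s)       = ≈-neg a n (dualB 𝓑) s
φ-cong (≈-iso a n 𝓑 𝓑′ s σ iso) =
  ≈-iso a n (dualB 𝓑) (dualB 𝓑′) s σ λ B → trans (cong 𝓑′ (∁-image σ B)) (iso (∁ B))

φ-involutive : ∀ x → φ (φ x) ≈ x
φ-involutive []                    = ≈-refl
φ-involutive ((a , omat n 𝓑 s) ∷ x) =
  ≈-++ (≈-bases a n s (cong 𝓑 ∘ ∁-involutive)) (φ-involutive x)

filter-T-cong : ∀ {A : Set} {f g : A → Bool} → f ≗ g →
                ∀ xs → filter (λ x → T? (f x)) xs ≡ filter (λ x → T? (g x)) xs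
filter-T-cong {f = f} {g} f≗g =
  filter-≐ (λ x → T? (f x)) (λ x → T? (g x)) ((λ {x} → subst T (f≗g x)) , λ {x} → subst T (sym (f≗g x)))

φ-termwise : ∀ {A : Set} a (h k : A → OMat) → (∀ x → [ (a , dualᴼ (h x)) ] ≈ [ (a , k x) ]) →
        ∀ xs → φ (map (a ,_) (map h xs)) ≈ map (a ,_) (map k xs)
φ-termwise a h k hk []       = ≈-refl
φ-termwise a h k hk (x ∷ xs) = ≈-++ (hk x) (φ-termwise a h k hk xs)

φ-delTerms : ∀ a M → φ (map (a ,_) (delTerms M)) ≈ map (a ,_) (conTerms (dualᴼ M))
φ-delTerms a (omat zero    𝓑 s) = ≈-refl
φ-delTerms a (omat (suc n) 𝓑 s)
  rewrite filter-T-cong (λ x → cong not (sym (isColoop≡isLoop-dual 𝓑 x))) (allFin (suc n)) =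
  φ-termwise a _ _ (λ x → ≈-bases a n _ (dualB-deleteB 𝓑 x)) _

φ-clpTerms : ∀ a M → φ (map (a ,_) (clpTerms M)) ≈ map (a ,_) (lpTerms (dualᴼ M))
φ-clpTerms a (omat zero    𝓑 s) = ≈-refl
φ-clpTerms a (omat (suc n) 𝓑 s)
  rewrite filter-T-cong (λ x → sym (isColoop≡isLoop-dual 𝓑 x)) (allFin (suc n)) =
  φ-termwise a _ _ (λ x → ≈-bases a n _ (dualB-deleteB 𝓑 x)) _

φ-linExt : ∀ f g → (∀ a M → φ (map (a ,_) (f M)) ≈ map (a ,_) (g (dualᴼ M))) →
           ∀ x → φ (linExt f x) ≈ linExt g (φ x)
φ-linExt f g fg []            = ≈-refl
φ-linExt f g fg ((a , M) ∷ x) rewrite φ-++ (map (a ,_) (f M)) (linExt f x) =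
  ≈-++ (fg a M) (φ-linExt f g fg x)

dual-hasNullityRank : ∀ {n} {𝓑 : BasisSystem n} {k r} →
                      HasNullityRank 𝓑 k r → HasNullityRank (dualB 𝓑) r k
dual-hasNullityRank {n} {𝓑} {k} {r} (n≡k+r , B , b , ∣B∣≡r) =
  trans n≡k+r (+-comm k r) , ∁ B , subst (IsBasis 𝓑) (sym (∁-involutive B)) b , ∣∁B∣≡k
  where
  open ≡-Reasoning
  ∣∁B∣≡k : ∣ ∁ B ∣ ≡ k
  ∣∁B∣≡k = begin
    ∣ ∁ B ∣       ≡⟨ ∣∁p∣≡n∸∣p∣ B ⟩
    n ∸ ∣ B ∣     ≡⟨ cong₂ _∸_ n≡k+r ∣B∣≡r ⟩
    k + r ∸ r     ≡⟨ m+n∸n≡m k r ⟩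
    k             ∎

φ-allMatroid : ∀ x → AllMatroid x → AllMatroid (φ x)
φ-allMatroid _ = map⁺ ∘ All.map dual-isMatroid

φ-inGrade : ∀ k r x → InGrade k r x → InGrade r k (φ x)
φ-inGrade k r x (y , x≈y , graded) =
  φ y , φ-cong x≈y , map⁺ (All.map (Product.map dual-isMatroid dual-hasNullityRank) graded)

proposition3p12 :
    (∀ x → AllMatroid x → AllMatroid (φ x))
    × (∀ x y → AllMatroid x → AllMatroid y → x ≈ y → φ x ≈ φ y)
    × (∀ x y → AllMatroid x → AllMatroid y → φ x ≈ φ y → x ≈ y)
    × (∀ y → AllMatroid y → ∃ λ x → AllMatroid x × φ x ≈ y)
    × (∀ k r x → InGrade k r x → InGrade r k (φ x))
    × (∀ k r y → InGrade r k y → ∃ λ x → InGrade k r x × φ x ≈ y)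
    × (∀ x → AllMatroid x → φ (∂del x) ≈ ∂con (φ x))
    × (∀ x → AllMatroid x → φ (∂clp x) ≈ ∂lp (φ x))
proposition3p12 =
  φ-allMatroid ,
  (λ _ _ _ _ → φ-cong) ,
  (λ x y _ _ φx≈φy → ≈-trans (≈-sym (φ-involutive x)) (≈-trans (φ-cong φx≈φy) (φ-involutive y))) ,
  (λ y y∈𝓜 → φ y , φ-allMatroid y y∈𝓜 , φ-involutive y) ,
  φ-inGrade ,
  (λ k r y y∈𝓜ᵣₖ → φ y , φ-inGrade r k y y∈𝓜ᵣₖ , φ-involutive y) ,
  (λ x _ → φ-linExt delTerms conTerms φ-delTerms x) ,
  (λ x _ → φ-linExt clpTerms lpTerms φ-clpTerms x)
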